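{- Let $\Gamma$ be a digraph, $F$ any maximum out forest of $\Gamma$, and $K_i$ any undominated knot of $\Gamma$. Then the restriction of $F$ to $K_i^+$ is a diverging tree.
   Context: $\Gamma$: finite loopless digraph. $w$ is reachable from $z$ if $w=z$ or there is a directed path from $z$ to $w$. A diverging forest is a digraph without circuits with all indegrees $\le1$; a diverging tree is a digraph without semicircuits having a vertex (root) from which every vertex is reachable. A maximum out forest is a spanning subgraph of $\Gamma$ that is a diverging forest with the maximum number of arcs. An undominated knot is a nonempty $K\subseteq V(\Gamma)$ whose vertices are mutually reachable and with no arc from a vertex outside $K$ to a vertex in $K$. For an undominated knot $K_i$, $K_i^+$ is the set of vertices reachable from $K_i$ and unreachable from all other undominated knots. The restriction of $F$ to a vertex set $U$ is the subgraph with vertex set $U$ and all arcs of $F$ having both ends in $U$. -}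

module Defs where

open import Data.Nat using (ℕ; zero; suc; _+_; _≤_)
open import Data.Nat.DivMod using (_mod_)
open import Data.Fin using (Fin; toℕ)
open import Data.Fin.Subset using (Subset; _∈_; _∉_)
open import Data.Bool using (Bool; true; false; if_then_else_)
open import Data.List using (List; map; allFin)
open import Data.Nat.ListAction using (sum)
open import Data.Product using (Σ; ∃; _×_; _,_)
open import Data.Sum using (_⊎_)
open import Data.Empty using (⊥)
open import Relation.Nullary using (¬_)
open import Relation.Binary.PropositionalEquality using (_≡_; _≢_)
open import Relation.Binary.Construct.Closure.Transitive using (TransClosure)
open import Function.Definitions using (Injective)

-- A finite digraph on the vertex set Fin n, given by its adjacency matrix:
-- G i j ≡ true  iff there is an arc i → j.
Digraph : ℕ → Set
Digraph n = Fin n → Fin n → Bool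

Arc : ∀ {n} → Digraph n → Fin n → Fin n → Set
Arc G i j = G i j ≡ true

Loopless : ∀ {n} → Digraph n → Set
Loopless G = ∀ i → G i i ≡ false

SpanningSubgraph : ∀ {n} → Digraph n → Digraph n → Set
SpanningSubgraph F G = ∀ i j → Arc F i j → Arc G i j

indeg : ∀ {n} → Digraph n → Fin n → ℕ
indeg {n} G j = sum (map (λ i → if G i j then 1 else 0) (allFin n))

numArcs : ∀ {n} → Digraph n → ℕ
numArcs {n} G = sum (map (indeg G) (allFin n))

-- The following notions are stated for an arbitrary arc relation E
-- (so that they apply to restrictions of digraphs).

DPath : ∀ {n} → (Fin n → Fin n → Set) → Fin n → Fin n → Set
DPath E z w = TransClosure E z w

Reachable : ∀ {n} → (Fin n → Fin n → Set) → Fin n → Fin n → Set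
Reachable E z w = (w ≡ z) ⊎ DPath E z w

HasCircuit : ∀ {n} → (Fin n → Fin n → Set) → Set
HasCircuit E = ∃ λ v → DPath E v v

next : ∀ {m} → Fin (suc m) → Fin (suc m)
next {m} t = suc (toℕ t) mod (suc m)

record Semicircuit {n} (E : Fin n → Fin n → Set) (k : ℕ) : Set where
  field
    vtx     : Fin (suc (suc k)) → Fin n
    arc     : Fin (suc (suc k)) → Fin n × Fin n
    vtx-inj : Injective _≡_ _≡_ vtx
    arc-inj : Injective _≡_ _≡_ arc
    arc-ok  : ∀ t → let (a , b) = arc t in
                E a b × ((a ≡ vtx t × b ≡ vtx (next t)) ⊎ (a ≡ vtx (next t) × b ≡ vtx t))

HasSemicircuit : ∀ {n} → (Fin n → Fin n → Set) → Set
HasSemicircuit E = ∃ λ k → Semicircuit E k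

DivergingForest : ∀ {n} → Digraph n → Set
DivergingForest F = ¬ HasCircuit (Arc F) × (∀ j → indeg F j ≤ 1)

MaximumOutForest : ∀ {n} → Digraph n → Digraph n → Set
MaximumOutForest Γ F =
  SpanningSubgraph F Γ × DivergingForest F ×
  (∀ F′ → SpanningSubgraph F′ Γ → DivergingForest F′ → numArcs F′ ≤ numArcs F)

UndominatedKnot : ∀ {n} → Digraph n → Subset n → Set
UndominatedKnot Γ K =
  (∃ λ v → v ∈ K) ×
  (∀ u v → u ∈ K → v ∈ K → Reachable (Arc Γ) u v) ×
  (∀ u v → u ∉ K → v ∈ K → ¬ Arc Γ u v)

KPlus : ∀ {n} → Digraph n → Subset n → Fin n → Set
KPlus Γ K v =
  (∃ λ x → x ∈ K × Reachable (Arc Γ) x v) ×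
  (∀ K′ → UndominatedKnot Γ K′ → K′ ≢ K → ∀ y → y ∈ K′ → ¬ Reachable (Arc Γ) y v)

Restrict : ∀ {n} → Digraph n → (Fin n → Set) → Fin n → Fin n → Set
Restrict F U i j = Arc F i j × U i × U j

DivergingTreeOn : ∀ {n} → (Fin n → Set) → (Fin n → Fin n → Set) → Set
DivergingTreeOn U E =
  ¬ HasSemicircuit E × (∃ λ r → U r × (∀ v → U v → Reachable E r v))

-- The heart of the proof is an exchange argument: if r is a root of a maximum out forest F and
-- w reaches r in Γ, then r reaches w in F. Induct along a Γ-path w = w₀ → w₁ → ⋯ → r; if r
-- reaches wᵢ₊₁ in F but not wᵢ, replace the F-arc entering wᵢ₊₁ by the arc wᵢ → wᵢ₊₁. This
-- keeps F a maximum out forest with root r and cuts wᵢ₊₁ off from r; for wᵢ₊₁ = r it would even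
-- add an arc. Hence the Γ-ancestors of a root form an undominated knot, so a root reaching a
-- vertex of K⁺ lies in K, and K contains only one root r. Every vertex of K⁺ hangs below r, and
-- the F-path to it stays in K⁺. A diverging forest has no semicircuits: along one, a forward arc
-- is never followed by a backward one (their common head would have indegree 2), so all arcs
-- point the same way and close up to a circuit.
--
-- Reachability is never decided: the classical steps run under ¬ ¬ and end in decidable goals.

module Submission where

open import Defs
open import Algebra.Properties.CommutativeSemigroup using (x∙yz≈y∙xz)
open import Data.Bool using (Bool; true; if_then_else_)
open import Data.Bool.Properties using (¬-not) renaming (_≟_ to _≟ᵇ_)
open import Data.Empty using (⊥; ⊥-elim)
open import Data.Fin using (Fin; zero; suc; toℕ; fromℕ; inject₁; punchIn; punchOut; _≟_)
open import Data.Fin.Induction using (<-weakInduction; >-weakInduction; spo-wellFounded)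
open import Data.Fin.Properties
  using (toℕ-injective; toℕ-fromℕ<; toℕ-fromℕ; toℕ-inject₁; toℕ<n; punchInᵢ≢i; punchIn-punchOut; any?)
open import Data.Fin.Subset using (Subset; _∈_; _∉_)
open import Data.Fin.Subset.Properties using (_∈?_; ⊆-antisym)
open import Data.List using (map; allFin; tabulate)
open import Data.List.Properties using (map-tabulate; map-cong)
open import Data.Nat using (ℕ; zero; suc; _+_; _%_; _≤_; s≤s; s≤s⁻¹)
open import Data.Nat.DivMod using (m<n⇒m%n≡m; n%n≡0)
open import Data.Nat.ListAction using (sum)
open import Data.Nat.Properties
  using ( +-0-commutativeMonoid; +-commutativeSemigroup; ≤-trans; ≤-reflexive; m≤m+n; +-monoʳ-≤; +-monoˡ-≤
        ; n<1+n; n≮n; module ≤-Reasoning)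
open import Data.Product using (Σ; ∃; _×_; _,_; proj₁; proj₂)
open import Data.Product.Properties using (×-≡,≡→≡)
open import Data.Sum using (_⊎_; inj₁; inj₂; [_,_]′)
import Data.Vec as Vec
open import Data.Vec.Properties using (lookup∘tabulate; lookup⇒[]=; []=⇒lookup)
open import Data.Vec.Functional using (removeAt)
open import Function using (_∘_; flip)
open import Induction.WellFounded using (Acc; acc)
open import Relation.Binary.Construct.Closure.Transitive using ([_]; _∷_; _++_; _∷ʳ_)
open import Relation.Binary.PropositionalEquality
open import Relation.Binary.Structures using (IsStrictPartialOrder)
open import Relation.Nullary using (¬_; Dec; yes; no; does)
open import Relation.Nullary.Decidable using (dec-true; dec-false; decidable-stable; ¬¬-excluded-middle)
open import Relation.Nullary.Negation using (contradiction; ¬¬-map)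

open import Algebra.Properties.CommutativeMonoid.Sum +-0-commutativeMonoid
  using (sum-remove; sum-cong-≗; sum-replicate-zero) renaming (sum to ∑)

sum-tabulate : ∀ {n} (f : Fin n → ℕ) → sum (tabulate f) ≡ ∑ f
sum-tabulate {zero}  f = refl
sum-tabulate {suc n} f = cong (f zero +_) (sum-tabulate (f ∘ suc))

sum-map-allFin : ∀ {n} (f : Fin n → ℕ) → sum (map f (allFin n)) ≡ ∑ f
sum-map-allFin {n} f = trans (cong sum (map-tabulate (λ i → i) f)) (sum-tabulate f)

∑-zero : ∀ {n} (f : Fin n → ℕ) → (∀ i → f i ≡ 0) → ∑ f ≡ 0
∑-zero {n} f f≡0 = trans (sum-cong-≗ f≡0) (sum-replicate-zero n)

∑-single : ∀ {n} (f : Fin n → ℕ) i → f i ≡ 1 → (∀ j → j ≢ i → f j ≡ 0) → ∑ f ≡ 1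
∑-single {suc n} f i fi≡1 rest =
  trans (sum-remove f) (cong₂ _+_ fi≡1 (∑-zero _ (λ k → rest (punchIn i k) (punchInᵢ≢i i k))))

f[i]≤∑f : ∀ {n} (f : Fin n → ℕ) i → f i ≤ ∑ f
f[i]≤∑f {suc n} f i = subst (f i ≤_) (sym (sum-remove f)) (m≤m+n (f i) _)

f[i]+f[j]≤∑f : ∀ {n} (f : Fin n → ℕ) {i j} → i ≢ j → f i + f j ≤ ∑ f
f[i]+f[j]≤∑f {suc n} f {i} {j} i≢j = begin
  f i + f j                               ≡⟨ cong (λ k → f i + f k) (punchIn-punchOut i≢j) ⟨
  f i + removeAt f i (punchOut i≢j)       ≤⟨ +-monoʳ-≤ (f i) (f[i]≤∑f (removeAt f i) (punchOut i≢j)) ⟩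
  f i + ∑ (removeAt f i)                  ≡⟨ sum-remove f ⟨
  ∑ f                                     ∎
  where open ≤-Reasoning

∑-differ-at : ∀ {n} (f g : Fin n → ℕ) i → (∀ j → j ≢ i → f j ≡ g j) → g i + ∑ f ≡ f i + ∑ g
∑-differ-at {suc n} f g i agree = begin
  g i + ∑ f                               ≡⟨ cong (g i +_) (sum-remove f) ⟩
  g i + (f i + ∑ (removeAt f i))          ≡⟨ x∙yz≈y∙xz +-commutativeSemigroup (g i) (f i) _ ⟩
  f i + (g i + ∑ (removeAt f i))          ≡⟨ cong (λ s → f i + (g i + s)) (sum-cong-≗ agree-off-i) ⟩
  f i + (g i + ∑ (removeAt g i))          ≡⟨ cong (f i +_) (sum-remove g) ⟨
  f i + ∑ g                               ∎
  where
  open ≡-Reasoning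
  agree-off-i : removeAt f i ≗ removeAt g i
  agree-off-i k = agree (punchIn i k) (punchInᵢ≢i i k)

module _ {n : ℕ} {E : Fin n → Fin n → Set} where

  reach-trans : ∀ {x y z} → Reachable E x y → Reachable E y z → Reachable E x z
  reach-trans (inj₁ refl) y⇝z         = y⇝z
  reach-trans (inj₂ p)    (inj₁ refl) = inj₂ p
  reach-trans (inj₂ p)    (inj₂ q)    = inj₂ (p ++ q)

  arc-reach : ∀ {x y z} → E x y → Reachable E y z → DPath E x z
  arc-reach e (inj₁ refl) = [ e ]
  arc-reach e (inj₂ p)    = e ∷ p

  reach-arc : ∀ {x y z} → Reachable E x y → E y z → DPath E x z
  reach-arc (inj₁ refl) e = [ e ]
  reach-arc (inj₂ p)    e = p ∷ʳ e

  last-arc : ∀ {x y} → DPath E x y → ∃ λ z → E z y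
  last-arc [ e ]   = _ , e
  last-arc (_ ∷ p) = last-arc p

  reverse-path : ∀ {x y} → DPath (flip E) x y → DPath E y x
  reverse-path [ e ]   = [ e ]
  reverse-path (e ∷ p) = reverse-path p ∷ʳ e

  circuit-flip : HasCircuit (flip E) → HasCircuit E
  circuit-flip (v , c) = v , reverse-path c

module _ {n : ℕ} {E E′ : Fin n → Fin n → Set} (E⊆E′ : ∀ {i j} → E i j → E′ i j) where

  path-mono : ∀ {x y} → DPath E x y → DPath E′ x y
  path-mono [ e ]   = [ E⊆E′ e ]
  path-mono (e ∷ p) = E⊆E′ e ∷ path-mono p

  reach-mono : ∀ {x y} → Reachable E x y → Reachable E′ x y
  reach-mono (inj₁ x≡y) = inj₁ x≡y
  reach-mono (inj₂ p)   = inj₂ (path-mono p)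

  semicircuit-mono : ∀ {k} → Semicircuit E k → Semicircuit E′ k
  semicircuit-mono sc = record
    { vtx = vtx ; arc = arc ; vtx-inj = vtx-inj ; arc-inj = arc-inj
    ; arc-ok = λ t → E⊆E′ (proj₁ (arc-ok t)) , proj₂ (arc-ok t) }
    where open Semicircuit sc

path-split : ∀ {n} {E₀ E₁ : Fin n → Fin n → Set} {a b} →
             (∀ {i j} → E₁ i j → E₀ i j ⊎ (i ≡ a × j ≡ b)) →
             ∀ {u v} → DPath E₁ u v → DPath E₀ u v ⊎ (Reachable E₀ u a × Reachable E₀ b v)
path-split split [ e ] with split e
... | inj₁ e₀            = inj₁ [ e₀ ]
... | inj₂ (refl , refl) = inj₂ (inj₁ refl , inj₁ refl)
path-split split (e ∷ p) with split e | path-split split p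
... | inj₁ e₀            | inj₁ q           = inj₁ (e₀ ∷ q)
... | inj₁ e₀            | inj₂ (y⇝a , b⇝v) = inj₂ (inj₂ (arc-reach e₀ y⇝a) , b⇝v)
... | inj₂ (refl , refl) | inj₁ q           = inj₂ (inj₁ refl , inj₂ q)
... | inj₂ (refl , refl) | inj₂ (_ , b⇝v)   = inj₂ (inj₁ refl , b⇝v)

module _ {n : ℕ} (F : Digraph n) (U : Fin n → Set) where

  path-within : ∀ {x v} → (∀ {u} → Reachable (Arc F) x u → Reachable (Arc F) u v → U u) →
                DPath (Arc F) x v → DPath (Restrict F U) x v
  path-within inU [ e ]   = [ e , inU (inj₁ refl) (inj₂ [ e ]) , inU (inj₂ [ e ]) (inj₁ refl) ]
  path-within inU (e ∷ p) =
    (e , inU (inj₁ refl) (inj₂ (e ∷ p)) , inU (inj₂ [ e ]) (inj₂ p))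
    ∷ path-within (λ y⇝u u⇝v → inU (inj₂ (arc-reach e y⇝u)) u⇝v) p

  reach-within : ∀ {x v} → (∀ {u} → Reachable (Arc F) x u → Reachable (Arc F) u v → U u) →
                 Reachable (Arc F) x v → Reachable (Restrict F U) x v
  reach-within inU (inj₁ v≡x) = inj₁ v≡x
  reach-within inU (inj₂ p)   = inj₂ (path-within inU p)

next-inject₁ : ∀ {m} (i : Fin m) → next (inject₁ i) ≡ suc i
next-inject₁ {m} i = toℕ-injective (begin
  toℕ (next (inject₁ i))          ≡⟨ toℕ-fromℕ< _ ⟩
  suc (toℕ (inject₁ i)) % suc m   ≡⟨ cong (λ k → suc k % suc m) (toℕ-inject₁ i) ⟩
  suc (toℕ i) % suc m             ≡⟨ m<n⇒m%n≡m (s≤s (toℕ<n i)) ⟩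
  suc (toℕ i)                     ∎)
  where open ≡-Reasoning

next-fromℕ : ∀ m → next (fromℕ m) ≡ zero
next-fromℕ m = toℕ-injective (begin
  toℕ (next (fromℕ m))            ≡⟨ toℕ-fromℕ< _ ⟩
  suc (toℕ (fromℕ m)) % suc m     ≡⟨ cong (λ k → suc k % suc m) (toℕ-fromℕ m) ⟩
  suc m % suc m                   ≡⟨ n%n≡0 (suc m) ⟩
  0                               ∎)
  where open ≡-Reasoning

closed-walk-circuit : ∀ {n m} {E : Fin n → Fin n → Set} (vtx : Fin (suc m) → Fin n) →
                      (∀ t → E (vtx t) (vtx (next t))) → HasCircuit E
closed-walk-circuit {m = m} {E} vtx step =
  vtx zero , reach-arc (walk (fromℕ m)) (subst (E (vtx (fromℕ m)) ∘ vtx) (next-fromℕ m) (step (fromℕ m)))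
  where
  walk : ∀ t → Reachable E (vtx zero) (vtx t)
  walk = <-weakInduction (λ t → Reachable E (vtx zero) (vtx t)) (inj₁ refl)
    (λ i w → inj₂ (reach-arc w (subst (E (vtx (inject₁ i)) ∘ vtx) (next-inject₁ i) (step (inject₁ i)))))

bit : Bool → ℕ
bit b = if b then 1 else 0

module _ {n : ℕ} where

  IsRoot : Digraph n → Fin n → Set
  IsRoot G r = ∀ i → ¬ Arc G i r

  indeg-∑ : ∀ (G : Digraph n) j → indeg G j ≡ ∑ (λ i → bit (G i j))
  indeg-∑ G j = sum-map-allFin (λ i → bit (G i j))

  numArcs-∑ : ∀ (G : Digraph n) → numArcs G ≡ ∑ (indeg G)
  numArcs-∑ G = sum-map-allFin (indeg G)

  indeg-root : ∀ {G r} → IsRoot G r → indeg G r ≡ 0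
  indeg-root {G} {r} root = trans (indeg-∑ G r) (∑-zero _ (λ i → cong bit (¬-not (root i))))

  in-arc-unique : ∀ {G : Digraph n} {a b j} → indeg G j ≤ 1 → Arc G a j → Arc G b j → a ≡ b
  in-arc-unique {G} {a} {b} {j} indeg≤1 a→j b→j with a ≟ b
  ... | yes a≡b = a≡b
  ... | no  a≢b = contradiction (≤-trans two≤indeg indeg≤1) λ { (s≤s ()) }
    where
    open ≤-Reasoning
    two≤indeg : 2 ≤ indeg G j
    two≤indeg = begin
      2                            ≡⟨ cong₂ (λ x y → bit x + bit y) a→j b→j ⟨
      bit (G a j) + bit (G b j)    ≤⟨ f[i]+f[j]≤∑f _ a≢b ⟩
      ∑ (λ i → bit (G i j))        ≡⟨ indeg-∑ G j ⟨
      indeg G j                    ∎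

  reach-root⇒≡ : ∀ {G r u} → IsRoot G r → Reachable (Arc G) u r → r ≡ u
  reach-root⇒≡ root (inj₁ r≡u) = r≡u
  reach-root⇒≡ root (inj₂ p)   = contradiction (proj₂ (last-arc p)) (root _)

  root-above : ∀ {G} → ¬ HasCircuit (Arc G) → ∀ v → ∃ λ r → IsRoot G r × Reachable (Arc G) r v
  root-above {G} acyclic v = go v (spo-wellFounded path-order v)
    where
    path-order : IsStrictPartialOrder _≡_ (DPath (Arc G))
    path-order = record
      { isEquivalence = isEquivalence
      ; irrefl        = λ { refl c → acyclic (_ , c) }
      ; trans         = _++_
      ; <-resp-≈      = resp₂ (DPath (Arc G))
      }
    go : ∀ v → Acc (DPath (Arc G)) v → ∃ λ r → IsRoot G r × Reachable (Arc G) r v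
    go v (acc above) with any? (λ u → G u v ≟ᵇ true)
    ... | yes (u , u→v) = let r , root , r⇝u = go u (above [ u→v ])
                          in r , root , inj₂ (reach-arc r⇝u u→v)
    ... | no  no-in-arc = v , (λ u u→v → no-in-arc (u , u→v)) , inj₁ refl

  redirect : Digraph n → Fin n → Fin n → Digraph n
  redirect G y w i j = if does (j ≟ y) then does (i ≟ w) else G i j

  module _ {G : Digraph n} {y w : Fin n} where

    redirect-arc : ∀ {i j} → Arc (redirect G y w) i j → (Arc G i j × j ≢ y) ⊎ (i ≡ w × j ≡ y)
    redirect-arc {i} {j} i→j with j ≟ y | i ≟ w
    ... | no j≢y  | _        = inj₁ (i→j , j≢y)
    ... | yes j≡y | yes i≡w  = inj₂ (i≡w , j≡y)
    ... | yes _   | no _     = contradiction i→j λ ()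

    indeg-redirect-≢ : ∀ {j} → j ≢ y → indeg (redirect G y w) j ≡ indeg G j
    indeg-redirect-≢ {j} j≢y = cong sum (map-cong unchanged (allFin n))
      where
      unchanged : ∀ i → bit (redirect G y w i j) ≡ bit (G i j)
      unchanged i rewrite dec-false (j ≟ y) j≢y = refl

    indeg-redirect-≡ : indeg (redirect G y w) y ≡ 1
    indeg-redirect-≡ = trans (indeg-∑ (redirect G y w) y) (∑-single _ w from-w not-from-w)
      where
      from-w : bit (redirect G y w w y) ≡ 1
      from-w rewrite dec-true (y ≟ y) refl | dec-true (w ≟ w) refl = refl
      not-from-w : ∀ i → i ≢ w → bit (redirect G y w i y) ≡ 0
      not-from-w i i≢w rewrite dec-true (y ≟ y) refl | dec-false (i ≟ w) i≢w = refl

    numArcs-redirect : indeg G y + numArcs (redirect G y w) ≡ suc (numArcs G)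
    numArcs-redirect = begin
      indeg G y + numArcs (redirect G y w)      ≡⟨ cong (indeg G y +_) (numArcs-∑ (redirect G y w)) ⟩
      indeg G y + ∑ (indeg (redirect G y w))    ≡⟨ ∑-differ-at _ _ y (λ j → indeg-redirect-≢) ⟩
      indeg (redirect G y w) y + ∑ (indeg G)    ≡⟨ cong₂ _+_ indeg-redirect-≡ (sym (numArcs-∑ G)) ⟩
      suc (numArcs G)                           ∎
      where open ≡-Reasoning

    redirect-forest : DivergingForest G → ¬ Reachable (Arc G) y w → DivergingForest (redirect G y w)
    redirect-forest (acyclic , indeg≤1) y⇝̸w = acyclic′ , indeg≤1′
      where
      acyclic′ : ¬ HasCircuit (Arc (redirect G y w))
      acyclic′ (v , c) with path-split redirect-arc c
      ... | inj₁ c₀          = acyclic (v , path-mono proj₁ c₀)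
      ... | inj₂ (v⇝w , y⇝v) = y⇝̸w (reach-mono proj₁ (reach-trans y⇝v v⇝w))
      indeg≤1′ : ∀ j → indeg (redirect G y w) j ≤ 1
      indeg≤1′ j = by-cases (j ≟ y)
        where
        by-cases : Dec (j ≡ y) → indeg (redirect G y w) j ≤ 1
        by-cases (yes refl) = ≤-reflexive indeg-redirect-≡
        by-cases (no j≢y)   = subst (_≤ 1) (sym (indeg-redirect-≢ j≢y)) (indeg≤1 j)

forest-no-semicircuit : ∀ {n} {F : Digraph n} → DivergingForest F → ¬ HasSemicircuit (Arc F)
forest-no-semicircuit {F = F} (acyclic , indeg≤1) (k , sc) =
  [ all-forward , all-backward ]′ (proj₂ (arc-ok zero))
  where
  open Semicircuit sc

  Forward Backward : Fin (suc (suc k)) → Set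
  Forward  t = proj₁ (arc t) ≡ vtx t        × proj₂ (arc t) ≡ vtx (next t)
  Backward t = proj₁ (arc t) ≡ vtx (next t) × proj₂ (arc t) ≡ vtx t

  arc-of : ∀ t → Arc F (proj₁ (arc t)) (proj₂ (arc t))
  arc-of t = proj₁ (arc-ok t)

  -- Arcs t and next t would both end in vtx (next t), so they coincide and t ≡ next t.
  no-collision : ∀ t → Forward t → Backward (next t) → ⊥
  no-collision t (a₁ , b₁) (a₂ , b₂) =
    acyclic (vtx t , [ subst (Arc F (vtx t) ∘ vtx) (sym t≡next) loop ])
    where
    loop : Arc F (vtx t) (vtx (next t))
    loop = subst₂ (Arc F) a₁ b₁ (arc-of t)
    same-tail : proj₁ (arc t) ≡ proj₁ (arc (next t))
    same-tail = in-arc-unique {G = F} (indeg≤1 _)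
      (subst (Arc F _) b₁ (arc-of t)) (subst (Arc F _) b₂ (arc-of (next t)))
    t≡next : t ≡ next t
    t≡next = arc-inj (×-≡,≡→≡ (same-tail , trans b₁ (sym b₂)))

  forward-next : ∀ t → Forward t → Forward (next t)
  forward-next t fw with proj₂ (arc-ok (next t))
  ... | inj₁ fw′ = fw′
  ... | inj₂ bw′ = ⊥-elim (no-collision t fw bw′)

  backward-prev : ∀ t → Backward (next t) → Backward t
  backward-prev t bw with proj₂ (arc-ok t)
  ... | inj₁ fw′ = ⊥-elim (no-collision t fw′ bw)
  ... | inj₂ bw′ = bw′

  all-forward : Forward zero → ⊥
  all-forward fw₀ = acyclic (closed-walk-circuit vtx (λ t → forward-arc t (forward t)))
    where
    forward : ∀ t → Forward t
    forward = <-weakInduction Forward fw₀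
      (λ i fw → subst Forward (next-inject₁ i) (forward-next (inject₁ i) fw))
    forward-arc : ∀ t → Forward t → Arc F (vtx t) (vtx (next t))
    forward-arc t (a , b) = subst₂ (Arc F) a b (arc-of t)

  all-backward : Backward zero → ⊥
  all-backward bw₀ = acyclic (circuit-flip (closed-walk-circuit vtx (λ t → backward-arc t (backward t))))
    where
    backward : ∀ t → Backward t
    backward = >-weakInduction Backward
      (backward-prev (fromℕ _) (subst Backward (sym (next-fromℕ _)) bw₀))
      (λ i bw → backward-prev (inject₁ i) (subst Backward (sym (next-inject₁ i)) bw))
    backward-arc : ∀ t → Backward t → Arc F (vtx (next t)) (vtx t)
    backward-arc t (a , b) = subst₂ (Arc F) a b (arc-of t)

module _ {n : ℕ} {Γ F : Digraph n} (maxF : MaximumOutForest Γ F) where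

  private
    forest : DivergingForest F
    forest = proj₁ (proj₂ maxF)

    at-most : ∀ F′ → SpanningSubgraph F′ Γ → DivergingForest F′ → numArcs F′ ≤ numArcs F
    at-most = proj₂ (proj₂ maxF)

  forest⊆Γ : ∀ {i j} → Arc F i j → Arc Γ i j
  forest⊆Γ = proj₁ maxF _ _

  redirect-maximum : ∀ {w y} → Arc Γ w y → ¬ Reachable (Arc F) y w → MaximumOutForest Γ (redirect F y w)
  redirect-maximum {w} {y} w→y y⇝̸w =
    sub′ , redirect-forest forest y⇝̸w , λ F″ sub″ forest″ → ≤-trans (at-most F″ sub″ forest″) grows
    where
    open ≤-Reasoning
    sub′ : SpanningSubgraph (redirect F y w) Γ
    sub′ i j i→j with redirect-arc {G = F} {y} {w} i→j
    ... | inj₁ (i→ᶠj , _)    = forest⊆Γ i→ᶠj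
    ... | inj₂ (refl , refl) = w→y
    grows : numArcs F ≤ numArcs (redirect F y w)
    grows = s≤s⁻¹ (begin
      suc (numArcs F)                          ≡⟨ numArcs-redirect {G = F} ⟨
      indeg F y + numArcs (redirect F y w)     ≤⟨ +-monoˡ-≤ _ (proj₂ forest y) ⟩
      suc (numArcs (redirect F y w))           ∎)

  -- Otherwise hanging r below w would add an arc to F.
  root-reaches-in-neighbour : ∀ {r w} → IsRoot F r → Arc Γ w r → ¬ ¬ Reachable (Arc F) r w
  root-reaches-in-neighbour {r} {w} root w→r r⇝̸w = n≮n (numArcs F) (begin-strict
    numArcs F                 <⟨ n<1+n (numArcs F) ⟩
    suc (numArcs F)           ≡⟨ numArcs-redirect {G = F} ⟨
    indeg F r + numArcs F′    ≡⟨ cong (_+ numArcs F′) (indeg-root {G = F} root) ⟩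
    numArcs F′                ≤⟨ at-most F′ (proj₁ maxF′) (proj₁ (proj₂ maxF′)) ⟩
    numArcs F                 ∎)
    where
    open ≤-Reasoning
    F′ : Digraph n
    F′ = redirect F r w
    maxF′ : MaximumOutForest Γ F′
    maxF′ = redirect-maximum w→r r⇝̸w

  exchange-step : ∀ {r w y} → IsRoot F r → Arc Γ w y → Reachable (Arc F) r y → ¬ Reachable (Arc F) r w →
                  Σ (Digraph n) λ F′ → MaximumOutForest Γ F′ × IsRoot F′ r × ¬ Reachable (Arc F′) r y
  exchange-step {r} {w} {y} root w→y r⇝y r⇝̸w =
    redirect F y w , redirect-maximum w→y y⇝̸w , root′ , r⇝̸y
    where
    y⇝̸w : ¬ Reachable (Arc F) y w
    y⇝̸w y⇝w = r⇝̸w (reach-trans r⇝y y⇝w)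
    y≢r : y ≢ r
    y≢r refl = root-reaches-in-neighbour root w→y r⇝̸w
    root′ : IsRoot (redirect F y w) r
    root′ i i→r with redirect-arc {G = F} i→r
    ... | inj₁ (i→ᶠr , _) = root i i→ᶠr
    ... | inj₂ (_ , r≡y)   = y≢r (sym r≡y)
    r⇝̸y : ¬ Reachable (Arc (redirect F y w)) r y
    r⇝̸y (inj₁ y≡r) = y≢r y≡r
    r⇝̸y (inj₂ p) with path-split (redirect-arc {G = F}) p
    ... | inj₁ p₀        = proj₂ (proj₂ (last-arc p₀)) refl
    ... | inj₂ (r⇝w , _) = r⇝̸w (reach-mono proj₁ r⇝w)

root-reaches-back : ∀ {n} {Γ F : Digraph n} {r w} → MaximumOutForest Γ F → IsRoot F r →
                    Reachable (Arc Γ) w r → ¬ ¬ Reachable (Arc F) r w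
root-reaches-back         maxF root (inj₁ refl) r⇝̸r = r⇝̸r (inj₁ refl)
root-reaches-back {Γ = Γ} maxF root (inj₂ p)       = along p maxF root
  where
  along : ∀ {F r w} → DPath (Arc Γ) w r → MaximumOutForest Γ F → IsRoot F r → ¬ ¬ Reachable (Arc F) r w
  along [ w→r ]   maxF root = root-reaches-in-neighbour maxF root w→r
  along (w→y ∷ p) maxF root r⇝̸w = ¬¬-excluded-middle λ where
    (yes r⇝y) → let F′ , maxF′ , root′ , r⇝̸y = exchange-step maxF root w→y r⇝y r⇝̸w
                in along p maxF′ root′ r⇝̸y
    (no r⇝̸y)  → along p maxF root r⇝̸y

¬¬-∀-Fin : ∀ {n} {P : Fin n → Set} → (∀ i → ¬ ¬ P i) → ¬ ¬ (∀ i → P i)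
¬¬-∀-Fin {zero}  _   k = k λ ()
¬¬-∀-Fin {suc n} ¬¬P k = ¬¬P zero λ p₀ → ¬¬-∀-Fin (¬¬P ∘ suc) λ ps → k λ where
  zero    → p₀
  (suc i) → ps i

¬¬-decidable : ∀ {n} (R : Fin n → Fin n → Set) → ¬ ¬ (∀ u v → Dec (R u v))
¬¬-decidable R = ¬¬-∀-Fin λ u → ¬¬-∀-Fin λ v → ¬¬-excluded-middle

module _ {n : ℕ} {P : Fin n → Set} (P? : ∀ i → Dec (P i)) where

  subset : Subset n
  subset = Vec.tabulate (does ∘ P?)

  ∈-subset⁺ : ∀ {i} → P i → i ∈ subset
  ∈-subset⁺ {i} p = lookup⇒[]= i subset (trans (lookup∘tabulate (does ∘ P?) i) (dec-true (P? i) p))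

  ∈-subset⁻ : ∀ {i} → i ∈ subset → P i
  ∈-subset⁻ {i} i∈ with P? i | trans (sym (lookup∘tabulate (does ∘ P?) i)) ([]=⇒lookup i∈)
  ... | yes p | _ = p
  ... | no  _ | ()

module _ {n : ℕ} {Γ : Digraph n} where

  knot-closed-backward : ∀ {K u v} → UndominatedKnot Γ K → Reachable (Arc Γ) u v → v ∈ K → u ∈ K
  knot-closed-backward         knot (inj₁ refl) v∈K = v∈K
  knot-closed-backward {K = K} knot (inj₂ p)    v∈K = path-closed p v∈K
    where
    arc-closed : ∀ {u v} → Arc Γ u v → v ∈ K → u ∈ K
    arc-closed {u} u→v v∈K = decidable-stable (u ∈? K) λ u∉K → proj₂ (proj₂ knot) _ _ u∉K v∈K u→v
    path-closed : ∀ {u v} → DPath (Arc Γ) u v → v ∈ K → u ∈ K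
    path-closed [ u→v ]   v∈K = arc-closed u→v v∈K
    path-closed (u→y ∷ p) v∈K = arc-closed u→y (path-closed p v∈K)

  knot-reaching-knot : ∀ {K K′ x y} → UndominatedKnot Γ K → UndominatedKnot Γ K′ →
                       y ∈ K′ → x ∈ K → Reachable (Arc Γ) y x → K′ ≡ K
  knot-reaching-knot {K} {K′} {y = y} knot knot′ y∈K′ x∈K y⇝x = ⊆-antisym K′⊆K K⊆K′
    where
    y∈K : y ∈ K
    y∈K = knot-closed-backward knot y⇝x x∈K
    K′⊆K : ∀ {u} → u ∈ K′ → u ∈ K
    K′⊆K u∈K′ = knot-closed-backward knot (proj₁ (proj₂ knot′) _ _ u∈K′ y∈K′) y∈K
    K⊆K′ : ∀ {u} → u ∈ K → u ∈ K′
    K⊆K′ u∈K = knot-closed-backward knot′ (proj₁ (proj₂ knot) _ _ u∈K y∈K) y∈K′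

  knot⊆KPlus : ∀ {K x} → UndominatedKnot Γ K → x ∈ K → KPlus Γ K x
  knot⊆KPlus knot x∈K = (_ , x∈K , inj₁ refl) ,
    λ K′ knot′ K′≢K y y∈K′ y⇝x → K′≢K (knot-reaching-knot knot knot′ y∈K′ x∈K y⇝x)

  KPlus-convex : ∀ {K u v} → KPlus Γ K v → (∃ λ x → x ∈ K × Reachable (Arc Γ) x u) →
                 Reachable (Arc Γ) u v → KPlus Γ K u
  KPlus-convex v∈K⁺ K⇝u u⇝v = K⇝u , λ K′ knot′ K′≢K y y∈K′ y⇝u →
    proj₂ v∈K⁺ K′ knot′ K′≢K y y∈K′ (reach-trans y⇝u u⇝v)

module _ {n : ℕ} {Γ F : Digraph n} (maxF : MaximumOutForest Γ F) where

  private
    reachΓ : ∀ {u v} → Reachable (Arc F) u v → Reachable (Arc Γ) u v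
    reachΓ = reach-mono (forest⊆Γ maxF)

  ancestors-knot : ∀ {ρ} → IsRoot F ρ → (reach? : ∀ u v → Dec (Reachable (Arc Γ) u v)) →
                   UndominatedKnot Γ (subset (λ u → reach? u ρ))
  ancestors-knot {ρ} root reach? = (ρ , ∈-subset⁺ ⇝ρ? (inj₁ refl)) , connected , undominated
    where
    ⇝ρ? : ∀ u → Dec (Reachable (Arc Γ) u ρ)
    ⇝ρ? u = reach? u ρ
    ρ⇝ : ∀ {w} → Reachable (Arc Γ) w ρ → Reachable (Arc Γ) ρ w
    ρ⇝ w⇝ρ = decidable-stable (reach? _ _) (¬¬-map reachΓ (root-reaches-back maxF root w⇝ρ))
    connected : ∀ u v → u ∈ subset ⇝ρ? → v ∈ subset ⇝ρ? → Reachable (Arc Γ) u v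
    connected u v u∈ v∈ = reach-trans (∈-subset⁻ ⇝ρ? u∈) (ρ⇝ (∈-subset⁻ ⇝ρ? v∈))
    undominated : ∀ u v → u ∉ subset ⇝ρ? → v ∈ subset ⇝ρ? → ¬ Arc Γ u v
    undominated u v u∉ v∈ u→v = u∉ (∈-subset⁺ ⇝ρ? (inj₂ (arc-reach u→v (∈-subset⁻ ⇝ρ? v∈))))

  root-reaching-KPlus∈knot : ∀ {K ρ v} → UndominatedKnot Γ K → IsRoot F ρ →
                             Reachable (Arc F) ρ v → KPlus Γ K v → ρ ∈ K
  root-reaching-KPlus∈knot {K} {ρ} knot root ρ⇝v v∈K⁺ =
    decidable-stable (ρ ∈? K) λ ρ∉K → ¬¬-decidable _ λ reach? →
      let ρ∈K′ = ∈-subset⁺ (λ u → reach? u ρ) (inj₁ refl) in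
      proj₂ v∈K⁺ _ (ancestors-knot root reach?) (λ K′≡K → ρ∉K (subst (ρ ∈_) K′≡K ρ∈K′))
        ρ ρ∈K′ (reachΓ ρ⇝v)

  roots-in-knot-≡ : ∀ {K ρ ρ′} → UndominatedKnot Γ K → IsRoot F ρ → IsRoot F ρ′ → ρ ∈ K → ρ′ ∈ K → ρ ≡ ρ′
  roots-in-knot-≡ {ρ = ρ} {ρ′} knot root root′ ρ∈K ρ′∈K = decidable-stable (ρ ≟ ρ′) λ ρ≢ρ′ →
    root-reaches-back maxF root′ (proj₁ (proj₂ knot) _ _ ρ∈K ρ′∈K) λ ρ′⇝ρ →
      ρ≢ρ′ (reach-root⇒≡ {G = F} root ρ′⇝ρ)

  knot-root-reaches-KPlus : ∀ {K r v} → UndominatedKnot Γ K → IsRoot F r → r ∈ K → KPlus Γ K v →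
                            Reachable (Arc F) r v
  knot-root-reaches-KPlus knot root r∈K v∈K⁺ with root-above (proj₁ (proj₁ (proj₂ maxF))) _
  ... | ρ , root-ρ , ρ⇝v
    with roots-in-knot-≡ knot root root-ρ r∈K (root-reaching-KPlus∈knot knot root-ρ ρ⇝v v∈K⁺)
  ... | refl = ρ⇝v

  reach-within-KPlus : ∀ {K r v} → r ∈ K → KPlus Γ K v → Reachable (Arc F) r v →
                       Reachable (Restrict F (KPlus Γ K)) r v
  reach-within-KPlus r∈K v∈K⁺ =
    reach-within F _ λ r⇝u u⇝v → KPlus-convex v∈K⁺ (_ , r∈K , reachΓ r⇝u) (reachΓ u⇝v)

proposition5 : (n : ℕ) (Γ : Digraph n) → Loopless Γ →
               (F : Digraph n) → MaximumOutForest Γ F →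
               (K : Subset n) → UndominatedKnot Γ K →
               DivergingTreeOn (KPlus Γ K) (Restrict F (KPlus Γ K))
proposition5 n Γ _ F maxF@(_ , forest , _) K knot@((x , x∈K) , _) with root-above (proj₁ forest) x
... | r , root , r⇝x = semicircuit-free , r , knot⊆KPlus knot r∈K , spans
  where
  r∈K : r ∈ K
  r∈K = root-reaching-KPlus∈knot maxF knot root r⇝x (knot⊆KPlus knot x∈K)
  semicircuit-free : ¬ HasSemicircuit (Restrict F (KPlus Γ K))
  semicircuit-free (k , sc) = forest-no-semicircuit forest (k , semicircuit-mono proj₁ sc)
  spans : ∀ v → KPlus Γ K v → Reachable (Restrict F (KPlus Γ K)) r v
  spans v v∈K⁺ = reach-within-KPlus maxF r∈K v∈K⁺ (knot-root-reaches-KPlus maxF knot root r∈K v∈K⁺)
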